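{- If a generator $g:\{0,1\}^n\to\{0,1\}^{m(n)}$ is super-bit(s), then the ensemble $g(U_n)$ is $\cap$-unpredictable.
   Context: A generator is a $\mathsf{P}/\mathsf{poly}$-computable family $g:\{0,1\}^n\to\{0,1\}^{m(n)}$ with $m(n)>n$. Here $g$ is called super-bit(s) if for every $D\in\mathsf{NP}/\mathsf{poly}$, every polynomial $p$, and all sufficiently large $n$, $\Pr[D(U_{m(n)})=1]-\Pr[D(g(U_n))=1]<1/p(n)$, where $U_k$ is uniform on $\{0,1\}^k$. A nondeterministic function-computing algorithm is a nondeterministic algorithm where on each input every computation branch yields one of $0,1,\bot$ and some branch yields $0$ or $1$; its output $\mathcal{A}(x)=c\in\{0,1\}$ if every branch yields $c$ or $\bot$, and $\mathcal{A}(x)=\bot$ otherwise. An ensemble $(Z_n)$ (with $Z_n$ over $\{0,1\}^{l(n)}$) is $\cap$-predictable if there exist a polynomial-time (nonuniform) nondeterministic function-computing algorithm $\mathcal{A}$, a polynomial $p$, infinitely many $n$, and for each such $n$ an $i(n)<|Z_n|$ with $\Pr[\mathcal{A}(Z_n[1\ldots i])=Z_n[i+1]]\ge 1/2+1/p(n)$ (where $z[1\ldots i]$ is the length-$i$ prefix and $z[i]$ the $i$-th bit); it is $\cap$-unpredictable otherwise. -}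

module Defs where

open import Data.Bool using (Bool; true; false; not; _∧_; _∨_; if_then_else_)
open import Data.Nat using (ℕ; zero; suc; _+_; _*_; _^_; _≤_; _<_; s≤s; z≤n; NonZero)
open import Data.Nat.Properties using (m^n≢0; <⇒≤)
open import Data.Fin using (Fin; fromℕ<)
open import Data.Vec using (Vec; []; _∷_; lookup; _++_; head)
import Data.Vec as Vec
open import Data.List using (List; []; _∷_; [_])
open import Data.Nat.ListAction using (sum)
open import Data.Bool.ListAction using (any)
import Data.List as List
open import Data.Maybe using (Maybe; just; nothing)
open import Data.Product using (Σ; ∃; _×_)
open import Data.Integer using (+_)
open import Data.Rational using (ℚ; _/_; 1ℚ; ½) renaming (_-_ to _-ℚ_; _*_ to _*ℚ_; _<_ to _<ℚ_; _≤_ to _≤ℚ_)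
open import Relation.Binary.PropositionalEquality using (_≡_)
open import Relation.Nullary using (¬_)

Bits : ℕ → Set
Bits n = Vec Bool n

allBits : (n : ℕ) → List (Bits n)
allBits zero    = [ [] ]
allBits (suc n) = List.map (true ∷_) (allBits n) List.++ List.map (false ∷_) (allBits n)

count : (n : ℕ) → (Bits n → Bool) → ℕ
count n E = sum (List.map (λ x → if E x then 1 else 0) (allBits n))

Pr : (n : ℕ) → (Bits n → Bool) → ℚ
Pr n E = (+ count n E) / (2 ^ n)
  where instance _ = m^n≢0 2 n

ℕ→ℚ : ℕ → ℚ
ℕ→ℚ k = (+ k) / 1

-- Polynomials with natural-number coefficients (constant term first)

Poly : Set
Poly = List ℕ

evalPoly : Poly → ℕ → ℕ
evalPoly []       x = 0
evalPoly (a ∷ as) x = a + x * evalPoly as x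

-- Boolean circuits (straight-line programs).
-- A circuit with n inputs and k wires; new gates are prepended.

data Gate (k : ℕ) : Set where
  const : Bool → Gate k
  neg   : Fin k → Gate k
  and   : Fin k → Fin k → Gate k
  or    : Fin k → Fin k → Gate k

evalGate : ∀ {k} → Gate k → Vec Bool k → Bool
evalGate (const b) w = b
evalGate (neg i)   w = not (lookup w i)
evalGate (and i j) w = lookup w i ∧ lookup w j
evalGate (or i j)  w = lookup w i ∨ lookup w j

data Circ (n : ℕ) : ℕ → Set where
  inputs : Circ n n
  _▷_    : ∀ {k} → Circ n k → Gate k → Circ n (suc k)

wires : ∀ {n k} → Circ n k → Bits n → Vec Bool k
wires inputs    x = x
wires (c ▷ g)   x = evalGate g (wires c x) ∷ wires c x

-- circuit with n inputs and m outputs; size = number of wires (inputs + gates)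
record Circuit (n m : ℕ) : Set where
  field
    size : ℕ
    body : Circ n size
    out  : Vec (Fin size) m

run : ∀ {n m} → Circuit n m → Bits n → Bits m
run C x = Vec.map (lookup (wires (Circuit.body C) x)) (Circuit.out C)

PpolyComputable : (m : ℕ → ℕ) → ((n : ℕ) → Bits n → Bits (m n)) → Set
PpolyComputable m g =
  Σ Poly λ q → Σ ((n : ℕ) → Circuit n (m n)) λ C →
    ∀ n → Circuit.size (C n) ≤ evalPoly q n × (∀ x → run (C n) x ≡ g n x)

record IsGenerator (m : ℕ → ℕ) (g : (n : ℕ) → Bits n → Bits (m n)) : Set where
  field
    stretch    : ∀ n → n < m n
    computable : PpolyComputable m g

record NPpoly : Set where
  field
    bound : Poly
    wit   : ℕ → ℕ
    circ  : (ℓ : ℕ) → Circuit (ℓ + wit ℓ) 1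
    small : ∀ ℓ → Circuit.size (circ ℓ) ≤ evalPoly bound ℓ

accepts : (D : NPpoly) → (ℓ : ℕ) → Bits ℓ → Bool
accepts D ℓ x = any (λ y → head (run (NPpoly.circ D ℓ) (x ++ y))) (allBits (NPpoly.wit D ℓ))

SuperBit : (m : ℕ → ℕ) → ((n : ℕ) → Bits n → Bits (m n)) → Set
SuperBit m g =
  (D : NPpoly) (p : Poly) → Σ ℕ λ N → ∀ n → N ≤ n →
    (Pr (m n) (accepts D (m n)) -ℚ Pr n (λ x → accepts D (m n) (g n x))) *ℚ ℕ→ℚ (evalPoly p n) <ℚ 1ℚ

-- Nondeterministic function-computing algorithms (nonuniform, poly-time):
-- a family of nondeterministic circuits indexed by input length i, with two
-- output bits per branch: [defined?, value].

record NondetCircFam : Set where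
  field
    bound : Poly
    wit   : ℕ → ℕ
    circ  : (i : ℕ) → Circuit (i + wit i) 2
    small : ∀ i → Circuit.size (circ i) ≤ evalPoly bound i

branch : (A : NondetCircFam) → (i : ℕ) → Bits i → Bits (NondetCircFam.wit A i) → Maybe Bool
branch A i x y with run (NondetCircFam.circ A i) (x ++ y)
... | true  ∷ b ∷ [] = just b
... | false ∷ _ ∷ [] = nothing

yields? : Maybe Bool → Bool → Bool
yields? (just b) c = if b then c else not c
yields? nothing  c = false

someBranch : (A : NondetCircFam) → (i : ℕ) → Bits i → Bool → Bool
someBranch A i x c = any (λ y → yields? (branch A i x y) c) (allBits (NondetCircFam.wit A i))

output : (A : NondetCircFam) → (i : ℕ) → Bits i → Maybe Bool
output A i x with someBranch A i x true | someBranch A i x false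
... | true  | false = just true
... | false | true  = just false
... | _     | _     = nothing

FunctionComputing : NondetCircFam → Set
FunctionComputing A = ∀ i (x : Bits i) →
  ∃ λ y → Σ Bool λ c → branch A i x y ≡ just c

-- Ensembles Z_n = sample_n(U_{seed n}) over {0,1}^{len n}

record Ensemble : Set where
  field
    seed   : ℕ → ℕ
    len    : ℕ → ℕ
    sample : (n : ℕ) → Bits (seed n) → Bits (len n)

generatorEnsemble : (m : ℕ → ℕ) → ((n : ℕ) → Bits n → Bits (m n)) → Ensemble
generatorEnsemble m g = record { seed = λ n → n ; len = m ; sample = g }

prefix : ∀ {A : Set} {l} (i : ℕ) → i ≤ l → Vec A l → Vec A i
prefix zero    _       _        = []
prefix (suc i) (s≤s p) (x ∷ xs) = x ∷ prefix i p xs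

eqMB : Maybe Bool → Bool → Bool
eqMB = yields?

-- Pr[ 𝒜(Z_n[1..i]) = Z_n[i+1] ] ≥ 1/2 + 1/p(n), written as (Pr − 1/2)·p(n) ≥ 1
CapPredictable : Ensemble → Set
CapPredictable Z =
  Σ NondetCircFam λ A → FunctionComputing A × Σ Poly λ p →
    ∀ N → Σ ℕ λ n → N ≤ n × Σ ℕ λ i → Σ (i < Ensemble.len Z n) λ i<l →
      1ℚ ≤ℚ (Pr (Ensemble.seed Z n)
                (λ x → eqMB (output A i (prefix i (<⇒≤ i<l) (Ensemble.sample Z n x)))
                            (lookup (Ensemble.sample Z n x) (fromℕ< i<l)))
              -ℚ ½) *ℚ ℕ→ℚ (evalPoly p n)

CapUnpredictable : Ensemble → Set
CapUnpredictable Z = ¬ CapPredictable Z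

{-# OPTIONS --safe #-}
-- Let 𝒜 predict the bit of g(U_n) after position i with advantage 1/p(n). The NP/poly test
-- "some branch of 𝒜 on the prefix of z outputs the complement of the next bit of z" accepts a
-- uniform z with probability at least ½: 𝒜 has a defined branch on every prefix, so of z and z
-- with that bit flipped at least one is accepted. It accepts g(x) only where 𝒜 does not output
-- the next bit, i.e. with probability at most ½ - 1/p(n), so it breaks the super-bit property.
-- As i depends on n, the infinitely many predictable n are thinned out so that their output
-- lengths m(n) strictly increase; the test at length ℓ then reads off i from the unique chosen
-- n with m(n) = ℓ.
module Submission where

open import Defs
open import Data.Bool using (Bool; true; false; not; T; _∧_; _∨_; _xor_; if_then_else_)
open import Data.Bool.Properties using (T-∨; not-involutive)
open import Data.Bool.ListAction using (any)
open import Data.Nat using (ℕ; zero; suc; _+_; _*_; _^_; _≤_; _<_; s≤s; s≤s⁻¹; z≤n; NonZero; _≟_)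
open import Data.Nat.Properties
open import Data.Nat.ListAction using (sum)
open import Data.Nat.ListAction.Properties using (sum-++)
open import Data.Nat.Tactic.RingSolver using (solve-∀)
open import Data.Fin using (Fin; zero; suc; toℕ; fromℕ<; _↑ˡ_; _↑ʳ_; #_)
open import Data.Fin.Properties using (toℕ-fromℕ<)
open import Data.Vec using (Vec; []; _∷_; lookup; _++_; head; updateAt)
open import Data.Vec.Properties using (lookup∘updateAt; lookup-++ˡ; lookup-++ʳ; lookup-map)
open import Data.List using ([]; _∷_; map) renaming (_++_ to _++ᴸ_)
open import Data.List.Properties using (map-++; map-∘; map-cong)
open import Data.List.Membership.Propositional using (_∈_; lose)
open import Data.List.Membership.Propositional.Properties using (∈-map⁺; ∈-++⁺ˡ; ∈-++⁺ʳ)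
open import Data.List.Relation.Unary.Any using (here)
open import Data.List.Relation.Unary.Any.Properties using (any⁺)
open import Data.Maybe using (Maybe; just; nothing)
open import Data.Product using (Σ; _×_; _,_; proj₁; proj₂)
open import Data.Sum using (inj₁; inj₂)
open import Data.Empty using (⊥-elim)
open import Data.Integer as ℤ using (+≤+)
import Data.Integer.Properties as ℤP
import Data.Integer.Tactic.RingSolver as ℤ-Solver
open import Data.Rational using (ℚ; _/_; 1ℚ; ½; 0ℚ; -_; toℚᵘ; nonNegative)
  renaming (_+_ to _+ℚ_; _-_ to _-ℚ_; _*_ to _*ℚ_; _≤_ to _≤ℚ_; _<_ to _<ℚ_)
import Data.Rational.Properties as ℚP
open import Data.Rational.Unnormalised as ℚᵘ using (mkℚᵘ; *≡*; *≤*)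
import Data.Rational.Unnormalised.Properties as ℚᵘP
open import Data.Rational.Solver using (module +-*-Solver)
open import Function using (_∘_; Equivalence)
open import Relation.Nullary using (yes; no)
open import Relation.Binary.Definitions using (tri<; tri≈; tri>)
open import Relation.Binary.PropositionalEquality
open import Algebra.Properties.CommutativeSemigroup +-commutativeSemigroup using (interchange)

flipAt : ∀ {n} → Fin n → Bits n → Bits n
flipAt j x = updateAt x j not

prefix-flipAt : ∀ {l} i (p : i ≤ l) (j : Fin l) (z : Bits l) → i ≤ toℕ j →
  prefix i p (flipAt j z) ≡ prefix i p z
prefix-flipAt zero    p       j       z       _       = refl
prefix-flipAt (suc i) (s≤s p) (suc j) (b ∷ z) (s≤s h) = cong (b ∷_) (prefix-flipAt i p j z h)

allBits-complete : ∀ {n} (x : Bits n) → x ∈ allBits n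
allBits-complete []          = here refl
allBits-complete (true ∷ x)  = ∈-++⁺ˡ (∈-map⁺ (true ∷_) (allBits-complete x))
allBits-complete (false ∷ x) = ∈-++⁺ʳ _ (∈-map⁺ (false ∷_) (allBits-complete x))

any-allBits : ∀ {n} (f : Bits n → Bool) (x : Bits n) → T (f x) → T (any f (allBits n))
any-allBits f x fx = any⁺ f (lose (allBits-complete x) fx)

any-cong : ∀ {A : Set} {f g : A → Bool} → (∀ x → f x ≡ g x) → ∀ xs → any f xs ≡ any g xs
any-cong f≗g []       = refl
any-cong f≗g (x ∷ xs) = cong₂ _∨_ (f≗g x) (any-cong f≗g xs)

count-split : ∀ n (E : Bits (suc n) → Bool) →
  count (suc n) E ≡ count n (E ∘ (true ∷_)) + count n (E ∘ (false ∷_))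
count-split n E = begin
  sum (map χ (map (true ∷_) L ++ᴸ map (false ∷_) L))            ≡⟨ cong sum (map-++ χ (map (true ∷_) L) _) ⟩
  sum (map χ (map (true ∷_) L) ++ᴸ map χ (map (false ∷_) L))    ≡⟨ sum-++ (map χ (map (true ∷_) L)) _ ⟩
  sum (map χ (map (true ∷_) L)) + sum (map χ (map (false ∷_) L))
    ≡⟨ sym (cong₂ _+_ (cong sum (map-∘ L)) (cong sum (map-∘ L))) ⟩
  count n (E ∘ (true ∷_)) + count n (E ∘ (false ∷_))             ∎
  where
  open ≡-Reasoning
  L = allBits n
  χ : Bits (suc n) → ℕ
  χ x = if E x then 1 else 0

count-mono : ∀ n {E F : Bits n → Bool} → (∀ x → T (E x) → T (F x)) → count n E ≤ count n F
count-mono zero {E} {F} E⇒F with E [] | F [] | E⇒F []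
... | true  | true  | _ = ≤-refl
... | true  | false | h = ⊥-elim (h _)
... | false | _     | _ = z≤n
count-mono (suc n) {E} {F} E⇒F rewrite count-split n E | count-split n F =
  +-mono-≤ (count-mono n (E⇒F ∘ (true ∷_))) (count-mono n (E⇒F ∘ (false ∷_)))

count-true : ∀ n → count n (λ _ → true) ≡ 2 ^ n
count-true zero = refl
count-true (suc n) rewrite count-split n (λ _ → true) | count-true n =
  cong (2 ^ n +_) (sym (+-identityʳ (2 ^ n)))

count-∨ : ∀ n (E F : Bits n → Bool) → count n (λ x → E x ∨ F x) ≤ count n E + count n F
count-∨ zero E F with E [] | F []
... | true  | true  = s≤s z≤n
... | true  | false = ≤-refl
... | false | _     = ≤-refl
count-∨ (suc n) E F rewrite count-split n E | count-split n F | count-split n (λ x → E x ∨ F x) =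
  ≤-trans (+-mono-≤ (count-∨ n _ _) (count-∨ n _ _))
    (≤-reflexive (interchange (count n (E ∘ (true ∷_))) (count n (F ∘ (true ∷_))) _ _))

count-disjoint : ∀ n {E F : Bits n → Bool} → (∀ x → T (E x) → T (not (F x))) →
  count n E + count n F ≤ 2 ^ n
count-disjoint zero {E} {F} disj with E [] | F [] | disj []
... | true  | true  | h = ⊥-elim (h _)
... | true  | false | _ = ≤-refl
... | false | true  | _ = ≤-refl
... | false | false | _ = z≤n
count-disjoint (suc n) {E} {F} disj rewrite count-split n E | count-split n F = begin
  (e₁ + e₀) + (f₁ + f₀)  ≡⟨ interchange e₁ e₀ f₁ f₀ ⟩
  (e₁ + f₁) + (e₀ + f₀)  ≤⟨ +-mono-≤ (count-disjoint n (disj ∘ (true ∷_))) (count-disjoint n (disj ∘ (false ∷_))) ⟩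
  2 ^ n + 2 ^ n          ≡⟨ cong (2 ^ n +_) (sym (+-identityʳ (2 ^ n))) ⟩
  2 ^ suc n              ∎
  where
  open ≤-Reasoning
  e₁ = count n (E ∘ (true ∷_))
  e₀ = count n (E ∘ (false ∷_))
  f₁ = count n (F ∘ (true ∷_))
  f₀ = count n (F ∘ (false ∷_))

count-flipAt : ∀ n (j : Fin n) (E : Bits n → Bool) → count n (E ∘ flipAt j) ≡ count n E
count-flipAt (suc n) zero E rewrite count-split n (E ∘ flipAt zero) | count-split n E =
  +-comm (count n (E ∘ (false ∷_))) _
count-flipAt (suc n) (suc j) E rewrite count-split n (E ∘ flipAt (suc j)) | count-split n E =
  cong₂ _+_ (count-flipAt n j (E ∘ (true ∷_))) (count-flipAt n j (E ∘ (false ∷_)))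

count-flip-cover : ∀ n (j : Fin n) {E : Bits n → Bool} → (∀ x → T (E x ∨ E (flipAt j x))) →
  2 ^ n ≤ count n E * 2
count-flip-cover n j {E} cover = begin
  2 ^ n                                  ≡⟨ count-true n ⟨
  count n (λ _ → true)                   ≤⟨ count-mono n (λ x _ → cover x) ⟩
  count n (λ x → E x ∨ E (flipAt j x))   ≤⟨ count-∨ n E (E ∘ flipAt j) ⟩
  count n E + count n (E ∘ flipAt j)     ≡⟨ cong (count n E +_) (count-flipAt n j E) ⟩
  count n E + count n E                  ≡⟨ cong (count n E +_) (+-identityʳ (count n E)) ⟨
  2 * count n E                          ≡⟨ *-comm 2 (count n E) ⟩
  count n E * 2                          ∎
  where open ≤-Reasoning

count-cong : ∀ n {E F : Bits n → Bool} → (∀ x → E x ≡ F x) → count n E ≡ count n F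
count-cong n E≗F = cong sum (map-cong (cong (λ b → if b then 1 else 0) ∘ E≗F) (allBits n))

/-≤-/ : ∀ a b d e .{{_ : NonZero d}} .{{_ : NonZero e}} → a * e ≤ b * d → (ℤ.+ a) / d ≤ℚ (ℤ.+ b) / e
/-≤-/ a b (suc d) (suc e) ae≤bd = ℚP.toℚᵘ-cancel-≤
  (ℚᵘP.≤-respʳ-≃ (ℚᵘP.≃-sym (ℚP.toℚᵘ-fromℚᵘ (mkℚᵘ (ℤ.+ b) e)))
    (ℚᵘP.≤-respˡ-≃ (ℚᵘP.≃-sym (ℚP.toℚᵘ-fromℚᵘ (mkℚᵘ (ℤ.+ a) d)))
      (*≤* (subst₂ ℤ._≤_ (ℤP.pos-* a (suc e)) (ℤP.pos-* b (suc d)) (+≤+ ae≤bd)))))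

/-+-/ : ∀ a b d .{{_ : NonZero d}} → (ℤ.+ a) / d +ℚ (ℤ.+ b) / d ≡ (ℤ.+ (a + b)) / d
/-+-/ a b (suc d) = ℚP.toℚᵘ-injective (begin
  toℚᵘ ((ℤ.+ a) / suc d +ℚ (ℤ.+ b) / suc d)       ≈⟨ ℚP.toℚᵘ-homo-+ ((ℤ.+ a) / suc d) ((ℤ.+ b) / suc d) ⟩
  toℚᵘ ((ℤ.+ a) / suc d) ℚᵘ.+ toℚᵘ ((ℤ.+ b) / suc d)
    ≈⟨ ℚᵘP.+-cong (ℚP.toℚᵘ-fromℚᵘ (mkℚᵘ (ℤ.+ a) d)) (ℚP.toℚᵘ-fromℚᵘ (mkℚᵘ (ℤ.+ b) d)) ⟩
  mkℚᵘ (ℤ.+ a) d ℚᵘ.+ mkℚᵘ (ℤ.+ b) d               ≈⟨ *≡* (trans (sameDenominator (ℤ.+ a) (ℤ.+ b) (ℤ.+ suc d))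
                                                      (sym (cong₂ ℤ._*_ (ℤP.pos-+ a b) (ℤP.pos-* (suc d) (suc d))))) ⟩
  mkℚᵘ (ℤ.+ (a + b)) d                           ≈⟨ ℚP.toℚᵘ-fromℚᵘ (mkℚᵘ (ℤ.+ (a + b)) d) ⟨
  toℚᵘ ((ℤ.+ (a + b)) / suc d)                   ∎)
  where
  open ℚᵘP.≃-Reasoning
  sameDenominator : ∀ x y s → (x ℤ.* s ℤ.+ y ℤ.* s) ℤ.* s ≡ (x ℤ.+ y) ℤ.* (s ℤ.* s)
  sameDenominator = ℤ-Solver.solve-∀

½≤Pr : ∀ n {E : Bits n → Bool} → 2 ^ n ≤ count n E * 2 → ½ ≤ℚ Pr n E
½≤Pr n {E} half = /-≤-/ 1 (count n E) 2 (2 ^ n) {{_}} {{m^n≢0 2 n}}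
  (subst (_≤ count n E * 2) (sym (*-identityˡ (2 ^ n))) half)

Pr+Pr≤1 : ∀ n {E F : Bits n → Bool} → count n E + count n F ≤ 2 ^ n → Pr n E +ℚ Pr n F ≤ℚ 1ℚ
Pr+Pr≤1 n {E} {F} bound = subst (_≤ℚ 1ℚ) (sym (/-+-/ (count n E) (count n F) (2 ^ n) {{m^n≢0 2 n}}))
  (/-≤-/ (count n E + count n F) 1 (2 ^ n) 1 {{m^n≢0 2 n}}
    (subst₂ _≤_ (sym (*-identityʳ _)) (sym (*-identityˡ (2 ^ n))) bound))

Pr-cong : ∀ n {E F : Bits n → Bool} → (∀ x → E x ≡ F x) → Pr n E ≡ Pr n F
Pr-cong n E≗F rewrite count-cong n E≗F = refl

0≤ℕ→ℚ : ∀ k → 0ℚ ≤ℚ ℕ→ℚ k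
0≤ℕ→ℚ k = /-≤-/ 0 k 1 1 z≤n

z-½≤x-y : ∀ {x y z : ℚ} → ½ ≤ℚ x → y +ℚ z ≤ℚ 1ℚ → z -ℚ ½ ≤ℚ x -ℚ y
z-½≤x-y {x} {y} {z} ½≤x y+z≤1 = begin
  z -ℚ ½                         ≡⟨ shift y z ½ ⟩
  (y +ℚ z) +ℚ (- y -ℚ ½)         ≤⟨ ℚP.+-monoˡ-≤ (- y -ℚ ½) y+z≤1 ⟩
  (½ +ℚ ½) +ℚ (- y -ℚ ½)         ≡⟨ cancel y ½ ⟩
  ½ -ℚ y                         ≤⟨ ℚP.+-monoˡ-≤ (- y) ½≤x ⟩
  x -ℚ y                         ∎
  where
  open ℚP.≤-Reasoning
  open +-*-Solver
  shift : ∀ y z h → z -ℚ h ≡ (y +ℚ z) +ℚ (- y -ℚ h)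
  shift = solve 3 (λ y z h → z :- h := (y :+ z) :+ (:- y :- h)) refl
  cancel : ∀ y h → (h +ℚ h) +ℚ (- y -ℚ h) ≡ h -ℚ y
  cancel = solve 2 (λ y h → (h :+ h) :+ (:- y :- h) := h :- y) refl

_+ᴾ_ : Poly → Poly → Poly
[]      +ᴾ q       = q
(a ∷ p) +ᴾ []      = a ∷ p
(a ∷ p) +ᴾ (b ∷ q) = (a + b) ∷ (p +ᴾ q)

evalPoly-+ᴾ : ∀ p q x → evalPoly (p +ᴾ q) x ≡ evalPoly p x + evalPoly q x
evalPoly-+ᴾ []      q       x = refl
evalPoly-+ᴾ (a ∷ p) []      x = sym (+-identityʳ _)
evalPoly-+ᴾ (a ∷ p) (b ∷ q) x rewrite evalPoly-+ᴾ p q x = distribute a b x (evalPoly p x) (evalPoly q x)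
  where
  distribute : ∀ a b x u v → a + b + x * (u + v) ≡ a + x * u + (b + x * v)
  distribute = solve-∀

evalPoly-mono : ∀ p {x y} → x ≤ y → evalPoly p x ≤ evalPoly p y
evalPoly-mono []      x≤y = z≤n
evalPoly-mono (a ∷ p) x≤y = +-monoʳ-≤ a (*-mono-≤ x≤y (evalPoly-mono p x≤y))

mapGate : ∀ {k k′} → (Fin k → Fin k′) → Gate k → Gate k′
mapGate ρ (const b) = const b
mapGate ρ (neg i)   = neg (ρ i)
mapGate ρ (and i j) = and (ρ i) (ρ j)
mapGate ρ (or i j)  = or (ρ i) (ρ j)

evalGate-mapGate : ∀ {k k′} (ρ : Fin k → Fin k′) (g : Gate k) {w : Vec Bool k} {w′ : Vec Bool k′} →
  (∀ j → lookup w′ (ρ j) ≡ lookup w j) → evalGate (mapGate ρ g) w′ ≡ evalGate g w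
evalGate-mapGate ρ (const b) w≈ = refl
evalGate-mapGate ρ (neg i)   w≈ = cong not (w≈ i)
evalGate-mapGate ρ (and i j) w≈ = cong₂ _∧_ (w≈ i) (w≈ j)
evalGate-mapGate ρ (or i j)  w≈ = cong₂ _∨_ (w≈ i) (w≈ j)

inputs≤size : ∀ {n k} → Circ n k → n ≤ k
inputs≤size inputs  = ≤-refl
inputs≤size (c ▷ g) = m≤n⇒m≤1+n (inputs≤size c)

-- The gates of c are appended to base, input j of c being read from wire σ j of base.
record Graft {a b k₀ k : ℕ} (base : Circ b k₀) (σ : Fin a → Fin k₀) (c : Circ a k) : Set where
  field
    size         : ℕ
    circ         : Circ b size
    wire         : Fin k → Fin size
    keep         : Fin k₀ → Fin size
    size≤        : size ≤ k + k₀
    wire-correct : ∀ x x′ → (∀ j → lookup (wires base x) (σ j) ≡ lookup x′ j) →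
                   ∀ j → lookup (wires circ x) (wire j) ≡ lookup (wires c x′) j
    keep-correct : ∀ x j → lookup (wires circ x) (keep j) ≡ lookup (wires base x) j

graft : ∀ {a b k₀ k} (base : Circ b k₀) (σ : Fin a → Fin k₀) (c : Circ a k) → Graft base σ c
graft {a} {k₀ = k₀} base σ inputs = record
  { size = k₀ ; circ = base ; wire = σ ; keep = λ j → j ; size≤ = m≤n+m k₀ a
  ; wire-correct = λ _ _ x≈x′ → x≈x′ ; keep-correct = λ _ _ → refl }
graft base σ (c ▷ g) = record
  { size = suc size ; circ = circ ▷ mapGate wire g ; wire = wire′ ; keep = suc ∘ keep
  ; size≤ = s≤s size≤ ; wire-correct = wire-correct′ ; keep-correct = keep-correct }
  where
  open Graft (graft base σ c)
  wire′ : Fin (suc _) → Fin (suc size)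
  wire′ zero    = zero
  wire′ (suc j) = suc (wire j)
  wire-correct′ : ∀ x x′ → (∀ j → lookup (wires base x) (σ j) ≡ lookup x′ j) →
                  ∀ j → lookup (wires (circ ▷ mapGate wire g) x) (wire′ j) ≡ lookup (wires (c ▷ g) x′) j
  wire-correct′ x x′ x≈x′ zero    = evalGate-mapGate wire g (wire-correct x x′ x≈x′)
  wire-correct′ x x′ x≈x′ (suc j) = wire-correct x x′ x≈x′ j

selectPrefix : ∀ i {l} w → i ≤ l → Fin (i + w) → Fin (l + w)
selectPrefix zero    {l} w _       j       = l ↑ʳ j
selectPrefix (suc i)     w (s≤s _) zero    = zero
selectPrefix (suc i)     w (s≤s p) (suc j) = suc (selectPrefix i w p j)

lookup-selectPrefix : ∀ i {l w} (p : i ≤ l) (z : Bits l) (y : Bits w) j →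
  lookup (z ++ y) (selectPrefix i w p j) ≡ lookup (prefix i p z ++ y) j
lookup-selectPrefix zero    _       z       y j       = lookup-++ʳ z y j
lookup-selectPrefix (suc i) (s≤s p) (b ∷ z) y zero    = refl
lookup-selectPrefix (suc i) (s≤s p) (b ∷ z) y (suc j) = lookup-selectPrefix i p z y j

refutation : Bits 2 → Bool → Bool
refutation (d ∷ v ∷ []) b = d ∧ (v xor b)

-- On inputs b, d, v the gates compute ¬ b, ¬ v, v ∧ ¬ b, ¬ v ∧ b, their disjunction, and d ∧ it.
refutationCirc : Circ 3 9
refutationCirc =
  (((((inputs ▷ neg (# 0)) ▷ neg (# 3)) ▷ and (# 4) (# 1)) ▷ and (# 1) (# 3)) ▷ or (# 1) (# 0)) ▷ and (# 6) (# 0)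

refutationCirc-correct : ∀ b r → lookup (wires refutationCirc (b ∷ r)) zero ≡ refutation r b
refutationCirc-correct true  (true  ∷ true  ∷ []) = refl
refutationCirc-correct true  (true  ∷ false ∷ []) = refl
refutationCirc-correct true  (false ∷ _     ∷ []) = refl
refutationCirc-correct false (true  ∷ true  ∷ []) = refl
refutationCirc-correct false (true  ∷ false ∷ []) = refl
refutationCirc-correct false (false ∷ _     ∷ []) = refl

module Subsequence {P : ℕ → Set} (m : ℕ → ℕ) (stretch : ∀ n → n < m n)
                   (often : ∀ N → Σ ℕ λ n → N ≤ n × P n) where

  threshold : ℕ → ℕ
  point     : ℕ → ℕ
  threshold zero    = 0
  threshold (suc k) = m (point k)
  point k = proj₁ (often (threshold k))

  point-holds : ∀ k → P (point k)
  point-holds k = proj₂ (proj₂ (often (threshold k)))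

  m∘point-increasing : ∀ k → m (point k) < m (point (suc k))
  m∘point-increasing k = ≤-<-trans (proj₁ (proj₂ (often (m (point k))))) (stretch (point (suc k)))

  k≤point : ∀ k → k ≤ point k
  k≤point zero    = z≤n
  k≤point (suc k) = ≤-trans (≤-<-trans (k≤point k) (stretch (point k))) (proj₁ (proj₂ (often (m (point k)))))

module PartialInverse (L : ℕ → ℕ) (L-increasing : ∀ k → L k < L (suc k))
                      {F : ℕ → Set} (value : ∀ k → F (L k)) where

  L-mono : ∀ {k j} → k < j → L k < L j
  L-mono {k} {suc j} k<1+j with m≤n⇒m<n∨m≡n (s≤s⁻¹ k<1+j)
  ... | inj₁ k<j  = <-trans (L-mono k<j) (L-increasing j)
  ... | inj₂ refl = L-increasing k

  L-injective : ∀ {k j} → L k ≡ L j → k ≡ j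
  L-injective {k} {j} Lk≡Lj with <-cmp k j
  ... | tri< k<j _ _ = ⊥-elim (<-irrefl Lk≡Lj (L-mono k<j))
  ... | tri≈ _ k≡j _ = k≡j
  ... | tri> _ _ j<k = ⊥-elim (<-irrefl (sym Lk≡Lj) (L-mono j<k))

  k≤L : ∀ k → k ≤ L k
  k≤L zero    = z≤n
  k≤L (suc k) = ≤-<-trans (k≤L k) (L-increasing k)

  search : (l : ℕ) → ℕ → Maybe (F l)
  search l zero = nothing
  search l (suc j) with L j ≟ l
  ... | yes Lj≡l = just (subst F Lj≡l (value j))
  ... | no  _    = search l j

  search-finds : ∀ k j → k < j → search (L k) j ≡ just (value k)
  search-finds k (suc j) k<1+j with L j ≟ L k
  ... | yes Lj≡Lk with L-injective Lj≡Lk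
  ...   | refl = cong (λ e → just (subst F e (value k))) (≡-irrelevant Lj≡Lk refl)
  search-finds k (suc j) k<1+j | no Lj≢Lk =
    search-finds k j (≤∧≢⇒< (s≤s⁻¹ k<1+j) (λ k≡j → Lj≢Lk (cong L (sym k≡j))))

  inverse : (l : ℕ) → Maybe (F l)
  inverse l = search l (suc l)

  inverse-correct : ∀ k → inverse (L k) ≡ just (value k)
  inverse-correct k = search-finds k (suc (L k)) (s≤s (k≤L k))

yields?-self : ∀ c → T (yields? (just c) c)
yields?-self true  = _
yields?-self false = _

module _ (A : NondetCircFam) where
  open NondetCircFam A

  yields?-branch-not : ∀ i x y b → yields? (branch A i x y) (not b) ≡ refutation (run (circ i) (x ++ y)) b
  yields?-branch-not i x y b with run (circ i) (x ++ y)
  ... | true  ∷ true  ∷ [] = refl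
  ... | true  ∷ false ∷ [] = not-involutive b
  ... | false ∷ _     ∷ [] = refl

  someBranch-total : FunctionComputing A → ∀ i x → Σ Bool λ c → T (someBranch A i x c)
  someBranch-total total i x with total i x
  ... | y , c , branch≡c = c , any-allBits _ y (subst (λ o → T (yields? o c)) (sym branch≡c) (yields?-self c))

  someBranch-not⇒¬output : ∀ i x b → T (someBranch A i x (not b)) → T (not (yields? (output A i x) b))
  someBranch-not⇒¬output i x true h with someBranch A i x true | someBranch A i x false
  someBranch-not⇒¬output i x true _  | true  | true  = _
  someBranch-not⇒¬output i x true _  | false | true  = _
  someBranch-not⇒¬output i x true () | _     | false
  someBranch-not⇒¬output i x false h with someBranch A i x true | someBranch A i x false
  someBranch-not⇒¬output i x false _  | true  | true  = _
  someBranch-not⇒¬output i x false _  | true  | false = _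
  someBranch-not⇒¬output i x false () | false | _

  module _ {l i : ℕ} (i<l : i < l) where

    before : Bits l → Bits i
    before = prefix i (<⇒≤ i<l)

    next : Bits l → Bool
    next z = lookup z (fromℕ< i<l)

    refutes : Bits l → Bool
    refutes z = someBranch A i (before z) (not (next z))

    predicts : Bits l → Bool
    predicts z = eqMB (output A i (before z)) (next z)

    refutes⇒¬predicts : ∀ z → T (refutes z) → T (not (predicts z))
    refutes⇒¬predicts z = someBranch-not⇒¬output i (before z) (next z)

    refutes-or-flipAt : FunctionComputing A → ∀ z → T (refutes z ∨ refutes (flipAt (fromℕ< i<l) z))
    refutes-or-flipAt total z
      rewrite prefix-flipAt i (<⇒≤ i<l) (fromℕ< i<l) z (≤-reflexive (sym (toℕ-fromℕ< i<l)))
            | lookup∘updateAt (fromℕ< i<l) {not} z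
      = one-of-both (next z) (proj₂ (someBranch-total total i (before z)))
      where
      S = someBranch A i (before z)
      one-of-both : ∀ {c} b → T (S c) → T (S (not b) ∨ S (not (not b)))
      one-of-both {true}  true  h = Equivalence.from T-∨ (inj₂ h)
      one-of-both {false} true  h = Equivalence.from T-∨ (inj₁ h)
      one-of-both {true}  false h = Equivalence.from T-∨ (inj₁ h)
      one-of-both {false} false h = Equivalence.from T-∨ (inj₂ h)

    ½≤Pr-refutes : FunctionComputing A → ½ ≤ℚ Pr l refutes
    ½≤Pr-refutes total = ½≤Pr l (count-flip-cover l (fromℕ< i<l) (refutes-or-flipAt total))

    Pr-refutes+Pr-predicts≤1 : ∀ {n} (G : Bits n → Bits l) → Pr n (refutes ∘ G) +ℚ Pr n (predicts ∘ G) ≤ℚ 1ℚ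
    Pr-refutes+Pr-predicts≤1 {n} G = Pr+Pr≤1 n (count-disjoint n (refutes⇒¬predicts ∘ G))

    module Refuter where
      private
        C = circ i
        module R = Graft (graft inputs (selectPrefix i (wit i) (<⇒≤ i<l)) (Circuit.body C))
        select : Fin 3 → Fin R.size
        select zero    = R.keep (fromℕ< i<l ↑ˡ wit i)
        select (suc j) = R.wire (lookup (Circuit.out C) j)
        module P = Graft (graft R.circ select refutationCirc)

      circuit : Circuit (l + wit i) 1
      circuit = record { size = P.size ; body = P.circ ; out = P.wire zero ∷ [] }

      circuit-correct : ∀ z y → head (run circuit (z ++ y)) ≡ yields? (branch A i (before z) y) (not (next z))
      circuit-correct z y = begin
        lookup (wires P.circ (z ++ y)) (P.wire zero)   ≡⟨ P.wire-correct (z ++ y) (b ∷ r) selected zero ⟩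
        lookup (wires refutationCirc (b ∷ r)) zero     ≡⟨ refutationCirc-correct b r ⟩
        refutation r b                                 ≡⟨ yields?-branch-not i (before z) y b ⟨
        yields? (branch A i (before z) y) (not b) ∎
        where
        open ≡-Reasoning
        b = next z
        r = run C (before z ++ y)
        selected : ∀ j → lookup (wires R.circ (z ++ y)) (select j) ≡ lookup (b ∷ r) j
        selected zero    = trans (R.keep-correct (z ++ y) _) (lookup-++ˡ z y (fromℕ< i<l))
        selected (suc j) = trans (R.wire-correct (z ++ y) _ (lookup-selectPrefix i (<⇒≤ i<l) z y) _)
                                 (sym (lookup-map j _ (Circuit.out C)))

      circuit-size : Circuit.size circuit ≤ 9 + (evalPoly bound l + (l + evalPoly bound l))
      circuit-size = begin
        P.size                                        ≤⟨ P.size≤ ⟩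
        9 + R.size                                    ≤⟨ +-monoʳ-≤ 9 R.size≤ ⟩
        9 + (Circuit.size C + (l + wit i))            ≤⟨ +-monoʳ-≤ 9 (+-mono-≤ size≤ (+-monoʳ-≤ l wit≤)) ⟩
        9 + (evalPoly bound l + (l + evalPoly bound l)) ∎
        where
        open ≤-Reasoning
        size≤ : Circuit.size C ≤ evalPoly bound l
        size≤ = ≤-trans (small i) (evalPoly-mono bound (<⇒≤ i<l))
        wit≤ : wit i ≤ evalPoly bound l
        wit≤ = ≤-trans (m+n≤o⇒n≤o i (inputs≤size (Circuit.body C))) size≤

  refuterBound : Poly
  refuterBound = (9 ∷ 1 ∷ []) +ᴾ (bound +ᴾ bound)

  evalPoly-refuterBound : ∀ l → evalPoly refuterBound l ≡ 9 + (evalPoly bound l + (l + evalPoly bound l))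
  evalPoly-refuterBound l
    rewrite evalPoly-+ᴾ (9 ∷ 1 ∷ []) (bound +ᴾ bound) l | evalPoly-+ᴾ bound bound l =
    rearrange l (evalPoly bound l)
    where
    rearrange : ∀ l B → 9 + l * (1 + l * 0) + (B + B) ≡ 9 + (B + (l + B))
    rearrange = solve-∀

  module _ (choose : (l : ℕ) → Maybe (Σ ℕ (_< l))) where
    private
      witness : ∀ l → Maybe (Σ ℕ (_< l)) → ℕ
      witness l nothing        = 0
      witness l (just (i , _)) = wit i

      test : ∀ l o → Circuit (l + witness l o) 1
      test l nothing           = record { size = suc (l + 0) ; body = inputs ▷ const false ; out = zero ∷ [] }
      test l (just (_ , i<l))  = Refuter.circuit i<l

      test-size : ∀ l o → Circuit.size (test l o) ≤ evalPoly refuterBound l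
      test-size l nothing rewrite evalPoly-refuterBound l =
        +-mono-≤ (m≤m+n 1 8) (≤-trans (+-monoʳ-≤ l z≤n) (m≤n+m (l + evalPoly bound l) (evalPoly bound l)))
      test-size l (just (_ , i<l)) rewrite evalPoly-refuterBound l = Refuter.circuit-size i<l

    refutingDistinguisher : NPpoly
    refutingDistinguisher = record
      { bound = refuterBound
      ; wit   = λ l → witness l (choose l)
      ; circ  = λ l → test l (choose l)
      ; small = λ l → test-size l (choose l)
      }

    accepts-refutingDistinguisher : ∀ {l i} (i<l : i < l) → choose l ≡ just (i , i<l) →
      ∀ z → accepts refutingDistinguisher l z ≡ refutes i<l z
    accepts-refutingDistinguisher {i = i} i<l chosen z rewrite chosen =
      any-cong (Refuter.circuit-correct i<l z) (allBits (wit i))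

proposition5p7 : (m : ℕ → ℕ) (g : (n : ℕ) → Bits n → Bits (m n)) →
    IsGenerator m g → SuperBit m g → CapUnpredictable (generatorEnsemble m g)
proposition5p7 m g gen superBit (A , total , p , often) =
  ℚP.<-irrefl refl (ℚP.≤-<-trans predicted (ℚP.≤-<-trans gap fooled))
  where
  open Subsequence m (IsGenerator.stretch gen) often
  index : ∀ k → Σ ℕ (_< m (point k))
  index k = proj₁ (point-holds k) , proj₁ (proj₂ (point-holds k))
  open PartialInverse (m ∘ point) m∘point-increasing {λ l → Σ ℕ (_< l)} index
  D = refutingDistinguisher A inverse
  k = proj₁ (superBit D p)
  n = point k
  i<l = proj₂ (index k)
  weight = ℕ→ℚ (evalPoly p n)
  predicted : 1ℚ ≤ℚ (Pr n (predicts A i<l ∘ g n) -ℚ ½) *ℚ weight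
  predicted = proj₂ (proj₂ (point-holds k))
  accepts≗refutes : ∀ z → accepts D (m n) z ≡ refutes A i<l z
  accepts≗refutes = accepts-refutingDistinguisher A inverse i<l (inverse-correct k)
  fooled : (Pr (m n) (refutes A i<l) -ℚ Pr n (refutes A i<l ∘ g n)) *ℚ weight <ℚ 1ℚ
  fooled = subst₂ (λ u v → (u -ℚ v) *ℚ weight <ℚ 1ℚ)
    (Pr-cong (m n) accepts≗refutes) (Pr-cong n (accepts≗refutes ∘ g n)) (proj₂ (superBit D p) n (k≤point k))
  gap : (Pr n (predicts A i<l ∘ g n) -ℚ ½) *ℚ weight ≤ℚ (Pr (m n) (refutes A i<l) -ℚ Pr n (refutes A i<l ∘ g n)) *ℚ weight
  gap = ℚP.*-monoʳ-≤-nonNeg weight {{nonNegative (0≤ℕ→ℚ (evalPoly p n))}}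
    (z-½≤x-y (½≤Pr-refutes A i<l total) (Pr-refutes+Pr-predicts≤1 A i<l (g n)))
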